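{- Let $\phi$ be a formula such that $\Vdash_{\mathscr{B},\mathfrak{R}_A}\phi$ for every maximally-consistent base $\mathscr{B}$ and every family $\mathfrak{R}_A=(\mathfrak{R}_a)_{a\in A}$ of $S5$-modal relations. Then $\phi$ is valid, i.e. $\Vdash_{\mathscr{B},\mathfrak{R}_A}\phi$ for every base $\mathscr{B}$ and every family $\mathfrak{R}_A$ of $S5$-modal relations.
   Context: Fix a countably infinite set of atomic formulae and a nonempty set $A$ of agents. Formulae: $\phi ::= p \mid \bot \mid \phi\to\phi \mid K_a\phi$ with $p$ atomic and $a\in A$. A base rule is written $p_1,\dots,p_n\Rightarrow p$, where $\{p_1,\dots,p_n\}$ is a finite (possibly empty) set of atoms and $p$ is an atom. A base is a countable set of base rules; $\Omega$ is the set of all bases. $\overline{\mathscr{B}}$ is the smallest set of atoms closed under the rules of $\mathscr{B}$. A base $\mathscr{B}$ is inconsistent iff every atom lies in $\overline{\mathscr{B}}$, and consistent otherwise. A base $\mathscr{B}$ is maximally-consistent iff it is consistent and for every base rule $\delta$, either $\delta\in\mathscr{B}$ or $\mathscr{B}\cup\{\delta\}$ is inconsistent. An $S5$-modal relation is a binary relation $\mathfrak{R}$ on $\Omega$ that is reflexive, transitive and Euclidean (if $\mathfrak{R}\mathscr{B}\mathscr{C}$ and $\mathfrak{R}\mathscr{B}\mathscr{D}$ then $\mathfrak{R}\mathscr{C}\mathscr{D}$) and satisfies, for all bases $\mathscr{B}$: (a) if $\mathscr{B}$ is inconsistent, there is an inconsistent $\mathscr{C}$ with $\mathfrak{R}\mathscr{B}\mathscr{C}$,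 and every $\mathscr{D}$ with $\mathfrak{R}\mathscr{B}\mathscr{D}$ is inconsistent; (b) if $\mathscr{B}$ is consistent, every $\mathscr{C}$ with $\mathfrak{R}\mathscr{B}\mathscr{C}$ is consistent; (c) for all $\mathscr{C}$, if $\mathfrak{R}\mathscr{B}\mathscr{C}$ then for every consistent $\mathscr{D}\supseteq\mathscr{B}$ there is $\mathscr{E}\supseteq\mathscr{C}$ with $\mathfrak{R}\mathscr{D}\mathscr{E}$; (d) for all consistent $\mathscr{C}$, if $\mathfrak{R}\mathscr{B}\mathscr{C}$ then for every $\mathscr{D}\subseteq\mathscr{B}$ there is $\mathscr{E}\subseteq\mathscr{C}$ with $\mathfrak{R}\mathscr{D}\mathscr{E}$. For a family $\mathfrak{R}_A=(\mathfrak{R}_a)_{a\in A}$ of $S5$-modal relations, validity at a base is defined inductively: $\Vdash_{\mathscr{B},\mathfrak{R}_A}p$ iff $p\in\overline{\mathscr{B}}$; $\Vdash_{\mathscr{B},\mathfrak{R}_A}\phi\to\psi$ iff $\phi\Vdash_{\mathscr{B},\mathfrak{R}_A}\psi$; $\Vdash_{\mathscr{B},\mathfrak{R}_A}\bot$ iff $\Vdash_{\mathscr{B},\mathfrak{R}_A}p$ for every atom $p$; $\Vdash_{\mathscr{B},\mathfrak{R}_A}K_a\phi$ iff $\Vdash_{\mathscr{C},\mathfrak{R}_A}\phi$ for all $\mathscr{C}$ with $\mathfrak{R}_a\mathscr{B}\mathscr{C}$; and for a nonempty set $\Gamma$ of formulae, $\Gamma\Vdash_{\mathscr{B},\mathfrak{R}_A}\phi$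 iff for every $\mathscr{C}\supseteq\mathscr{B}$, if $\Vdash_{\mathscr{C},\mathfrak{R}_A}\psi$ for all $\psi\in\Gamma$ then $\Vdash_{\mathscr{C},\mathfrak{R}_A}\phi$. -}

module Defs where

open import Level using (Level; 0ℓ) renaming (suc to lsuc)
open import Data.Nat using (ℕ; _<_)
open import Data.List using (List)
open import Data.List.Relation.Unary.All using (All)
open import Data.List.Relation.Unary.Linked using (Linked)
open import Data.Product using (Σ; _×_; _,_)
open import Data.Sum using (_⊎_)
open import Relation.Nullary using (¬_)
open import Relation.Binary.PropositionalEquality using (_≡_)

Atom : Set
Atom = ℕ

data Formula (A : Set) : Set where
  atom : Atom → Formula A
  ⊥f   : Formula A
  _⇒_  : Formula A → Formula A → Formula A
  K    : A → Formula A → Formula A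

infixr 5 _⇒_

-- A base rule  p₁,…,pₙ ⇒ p.  The finite set of premises {p₁,…,pₙ} is
-- represented canonically as a strictly increasing list of atoms, so
-- that each finite set corresponds to exactly one list.
record Rule : Set where
  constructor rule
  field
    premises   : List Atom
    canonical  : Linked _<_ premises
    conclusion : Atom
open Rule public

-- A base is a set of base rules (every set of rules is countable, since
-- there are only countably many rules).  Ω is the type Base.
Base : Set₁
Base = Rule → Set

_⊆_ : Base → Base → Set
B ⊆ C = ∀ r → B r → C r

_∪｛_｝ : Base → Rule → Base
(B ∪｛ δ ｝) r = B r ⊎ r ≡ δ

data Closure (B : Base) : Atom → Set where
  apply : (δ : Rule) → B δ → All (Closure B) (premises δ) →
          Closure B (conclusion δ)

Inconsistent : Base → Set
Inconsistent B = ∀ (p : Atom) → Closure B p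

Consistent : Base → Set
Consistent B = ¬ Inconsistent B

MaximallyConsistent : Base → Set
MaximallyConsistent B =
  Consistent B × (∀ (δ : Rule) → B δ ⊎ Inconsistent (B ∪｛ δ ｝))

BaseRel : Set₁
BaseRel = Base → Base → Set

record IsS5 (R : BaseRel) : Set₁ where
  field
    reflexive  : ∀ B → R B B
    transitive : ∀ B C D → R B C → R C D → R B D
    euclidean  : ∀ B C D → R B C → R B D → R C D
    condA      : ∀ B → Inconsistent B →
                 Σ Base (λ C → Inconsistent C × R B C) ×
                 (∀ D → R B D → Inconsistent D)
    condB      : ∀ B → Consistent B → ∀ C → R B C → Consistent C
    condC      : ∀ B C → R B C → ∀ D → Consistent D → B ⊆ D →
                 Σ Base (λ E → C ⊆ E × R D E)
    condD      : ∀ B C → Consistent C → R B C → ∀ D → D ⊆ B →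
                 Σ Base (λ E → E ⊆ C × R D E)

Forces : {A : Set} → (A → BaseRel) → Base → Formula A → Set₁
Forces R B (atom p) = Level.Lift (lsuc 0ℓ) (Closure B p)
Forces R B ⊥f       = Level.Lift (lsuc 0ℓ) (Inconsistent B)
Forces R B (φ ⇒ ψ)  = ∀ C → B ⊆ C → Forces R C φ → Forces R C ψ
Forces R B (K a φ)  = ∀ C → R a B C → Forces R C φ

-- A consistent base B has a maximally-consistent extension with the same
-- closure: the base of all rules admissible in B, i.e. all rules under which
-- the closure of B is closed (excluded middle makes it maximal).  Hence atoms
-- and ⊥ forced at every maximally-consistent extension of B are forced at B.
-- For φ ⇒ ψ this reduces to ψ by monotonicity of forcing (condition (d)).
-- For K_a φ, given R_a B C and a maximally-consistent N ⊇ C, symmetry of R_a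
-- with conditions (b) and (c) yields a maximally-consistent M ⊇ B with an
-- R_a-successor F such that N ⊆ F; F is consistent, so F ⊆ N by maximality
-- of N, and φ passes from F to N by monotonicity.
module Submission where

open import Defs
open import Level using (0ℓ; lift; lower) renaming (suc to lsuc)
open import Axiom.ExcludedMiddle using (ExcludedMiddle)
open import Data.List using ([]; _∷_)
open import Data.List.Relation.Unary.All using (All; []; _∷_)
open import Data.List.Relation.Unary.Linked using ([-])
open import Data.Product using (Σ; _×_; _,_; proj₁; proj₂)
open import Data.Sum using (_⊎_; inj₁; inj₂)
open import Relation.Nullary using (¬_; Dec; yes; no; contradiction)
open import Relation.Nullary.Decidable using (map′)
open import Relation.Binary.PropositionalEquality using (refl)

⊆-refl : ∀ {B} → B ⊆ B
⊆-refl _ x = x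

⊆-trans : ∀ {B C D} → B ⊆ C → C ⊆ D → B ⊆ D
⊆-trans B⊆C C⊆D r x = C⊆D r (B⊆C r x)

mutual
  closure-mono : ∀ {B C p} → B ⊆ C → Closure B p → Closure C p
  closure-mono B⊆C (apply δ δ∈B ps) = apply δ (B⊆C δ δ∈B) (closure-mono-All B⊆C ps)

  closure-mono-All : ∀ {B C ps} → B ⊆ C → All (Closure B) ps → All (Closure C) ps
  closure-mono-All B⊆C []       = []
  closure-mono-All B⊆C (c ∷ cs) = closure-mono B⊆C c ∷ closure-mono-All B⊆C cs

inconsistent-mono : ∀ {B C} → B ⊆ C → Inconsistent B → Inconsistent C
inconsistent-mono B⊆C inc p = closure-mono B⊆C (inc p)

maximal-⊇⇒⊆ : ∀ {N F} → MaximallyConsistent N → N ⊆ F → Consistent F → F ⊆ N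
maximal-⊇⇒⊆ {N} {F} (_ , maximal) N⊆F consF δ δ∈F with maximal δ
... | inj₁ δ∈N = δ∈N
... | inj₂ inc = contradiction (inconsistent-mono N∪δ⊆F inc) consF
  where
  N∪δ⊆F : (N ∪｛ δ ｝) ⊆ F
  N∪δ⊆F r (inj₁ r∈N) = N⊆F r r∈N
  N∪δ⊆F r (inj₂ refl) = δ∈F

S5-symmetric : ∀ {R} → IsS5 R → ∀ {B C} → R B C → R C B
S5-symmetric S {B} {C} rBC = IsS5.euclidean S B C B rBC (IsS5.reflexive S B)

Admissible : Base → Base
Admissible B δ = All (Closure B) (premises δ) → Closure B (conclusion δ)

⊆-admissible : ∀ {B} → B ⊆ Admissible B
⊆-admissible δ δ∈B = apply δ δ∈B

mutual
  closure-admissible : ∀ {B p} → Closure (Admissible B) p → Closure B p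
  closure-admissible (apply δ admissible ps) = admissible (closure-admissible-All ps)

  closure-admissible-All : ∀ {B ps} → All (Closure (Admissible B)) ps → All (Closure B) ps
  closure-admissible-All []       = []
  closure-admissible-All (c ∷ cs) = closure-admissible c ∷ closure-admissible-All cs

admissible-consistent : ∀ {B} → Consistent B → Consistent (Admissible B)
admissible-consistent consB inc = consB (λ p → closure-admissible (inc p))

-- Each rule c ⇒ p with c underivable in B is admissible in B.
underivable-explodes : ∀ {B C c} → Admissible B ⊆ C → ¬ Closure B c →
                       Closure C c → Inconsistent C
underivable-explodes {c = c} admissible⊆C ¬c c∈C p =
  apply (rule (c ∷ []) [-] p) (admissible⊆C _ λ { (c∈B ∷ []) → contradiction c∈B ¬c }) (c∈C ∷ [])

module _ {A : Set} (R : A → BaseRel) (S5 : ∀ a → IsS5 (R a)) where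

  inconsistent-forces : ∀ φ {B} → Inconsistent B → Forces R B φ
  inconsistent-forces (atom p) inc           = lift (inc p)
  inconsistent-forces ⊥f       inc           = lift inc
  inconsistent-forces (φ ⇒ ψ)  inc C B⊆C _   = inconsistent-forces ψ (inconsistent-mono B⊆C inc)
  inconsistent-forces (K a φ)  {B} inc C rBC =
    inconsistent-forces φ (proj₂ (IsS5.condA (S5 a) B inc) C rBC)

module _ (em : ExcludedMiddle (lsuc 0ℓ)) where

  private
    dec : (P : Set) → Dec P
    dec P = map′ lower lift em

  admissible-maximallyConsistent : ∀ {B} → Consistent B → MaximallyConsistent (Admissible B)
  admissible-maximallyConsistent {B} consB = admissible-consistent consB , maximal
    where
    maximal : ∀ δ → Admissible B δ ⊎ Inconsistent (Admissible B ∪｛ δ ｝)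
    maximal δ with dec (Closure B (conclusion δ)) | dec (All (Closure B) (premises δ))
    ... | yes c | _     = inj₁ λ _ → c
    ... | no ¬c | no ¬a = inj₁ λ a → contradiction a ¬a
    ... | no ¬c | yes a = inj₂ (underivable-explodes admissible⊆ ¬c
                                  (apply δ (inj₂ refl) (closure-mono-All (⊆-trans ⊆-admissible admissible⊆) a)))
      where
      admissible⊆ : Admissible B ⊆ (Admissible B ∪｛ δ ｝)
      admissible⊆ _ = inj₁

  closure-from-maximal : ∀ {B p} → (∀ M → MaximallyConsistent M → B ⊆ M → Closure M p) →
                         Closure B p
  closure-from-maximal {B} {p} h with dec (Inconsistent B)
  ... | yes inc  = inc p
  ... | no consB = closure-admissible
                     (h (Admissible B) (admissible-maximallyConsistent consB) ⊆-admissible)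

  S5-extend-to-maximal : ∀ {R} → IsS5 R → ∀ {B C N} → R B C → MaximallyConsistent N → C ⊆ N →
                         Σ Base λ M → MaximallyConsistent M × B ⊆ M × Σ Base λ F → R M F × F ⊆ N
  S5-extend-to-maximal S {B} {C} {N} rBC mcN@(consN , _) C⊆N =
    let E , B⊆E , rNE = IsS5.condC S C B (S5-symmetric S rBC) N consN C⊆N
        mcM = admissible-maximallyConsistent (IsS5.condB S N consN E rNE)
        F , N⊆F , rMF = IsS5.condC S E N (S5-symmetric S rNE) (Admissible E) (proj₁ mcM) ⊆-admissible
        consF = IsS5.condB S (Admissible E) (proj₁ mcM) F rMF
    in Admissible E , mcM , ⊆-trans B⊆E ⊆-admissible , F , rMF , maximal-⊇⇒⊆ mcN N⊆F consF

  module _ {A : Set} (R : A → BaseRel) (S5 : ∀ a → IsS5 (R a)) where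

    forces-mono : ∀ φ {B C} → B ⊆ C → Forces R B φ → Forces R C φ
    forces-mono (atom p) B⊆C (lift p∈B)   = lift (closure-mono B⊆C p∈B)
    forces-mono ⊥f       B⊆C (lift inc)   = lift (inconsistent-mono B⊆C inc)
    forces-mono (φ ⇒ ψ)  B⊆C f D C⊆D      = f D (⊆-trans B⊆C C⊆D)
    forces-mono (K a φ) {B} {C} B⊆C f E rCE with dec (Inconsistent E)
    ... | yes inc  = inconsistent-forces R S5 φ inc
    ... | no consE with IsS5.condD (S5 a) C E consE rCE B B⊆C
    ...   | E′ , E′⊆E , rBE′ = forces-mono φ E′⊆E (f E′ rBE′)

    forces-from-maximal : ∀ φ {B} → (∀ M → MaximallyConsistent M → B ⊆ M → Forces R M φ) →
                          Forces R B φ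
    forces-from-maximal (atom p) h = lift (closure-from-maximal λ M mcM B⊆M → lower (h M mcM B⊆M))
    forces-from-maximal ⊥f       h =
      lift λ p → closure-from-maximal λ M mcM B⊆M → lower (h M mcM B⊆M) p
    forces-from-maximal (φ ⇒ ψ)  h C B⊆C fφ = forces-from-maximal ψ λ M mcM C⊆M →
      h M mcM (⊆-trans B⊆C C⊆M) M ⊆-refl (forces-mono φ C⊆M fφ)
    forces-from-maximal (K a φ)  h C rBC = forces-from-maximal φ λ N mcN C⊆N →
      let M , mcM , B⊆M , F , rMF , F⊆N = S5-extend-to-maximal (S5 a) rBC mcN C⊆N
      in forces-mono φ F⊆N (h M mcM B⊆M F rMF)

corollary4p9 : ExcludedMiddle (lsuc 0ℓ) →
    (A : Set) → A → (φ : Formula A) →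
    (∀ (R : A → BaseRel) → (∀ a → IsS5 (R a)) →
       ∀ B → MaximallyConsistent B → Forces R B φ) →
    ∀ (R : A → BaseRel) → (∀ a → IsS5 (R a)) → ∀ B → Forces R B φ
corollary4p9 em A _ φ valid-at-maximal R S5 B =
  forces-from-maximal em R S5 φ λ M mcM _ → valid-at-maximal R S5 M mcM
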